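{- Let $(S,=,\#)$ be a set with apartness, $(T,=,\#;\sigma)$ a co-quasiordered set with apartness, and $f:S\to T$ an se-mapping. Then: (i) $\mu_f$ is a co-quasiorder on $S$; (ii) $\kappa_f=\mu_f\cup\mu_f^{ -1}$ is a co-equivalence on $S$ with $\kappa_f\subseteq\mathrm{coker}\,f$; (iii) if $\sigma$ is a co-order on $T$, then $\kappa_f=\mathrm{coker}\,f$; (iv) $(S/\kappa_f^c,=,\#;\Upsilon_f)$ is a co-ordered set with apartness, where $(x\kappa_f^c,y\kappa_f^c)\in\Upsilon_f\iff(x,y)\in\mu_f$; (v) the mapping $\psi:S/\kappa_f^c\to T/\kappa_\sigma^c$, $\psi(x\kappa_f^c)=f(x)\kappa_\sigma^c$, between the co-ordered sets with apartness $(S/\kappa_f^c,\Upsilon_f)$ and $(T/\kappa_\sigma^c,\Upsilon_\sigma)$ is an isotone and reverse isotone a-injective se-mapping such that $\psi\pi_f=\pi_\sigma f$.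
   Context: Constructive (Bishop-style) setting. A set with apartness: inhabited set with equality $=$ (an equivalence) and $\#$ with $\neg(x\#x)$, $x\#y\Rightarrow y\#x$, $x\#z\Rightarrow\forall y(x\#y\vee y\#z)$, extensional w.r.t. $=$; $S\times S$ has apartness $(s,t)\#(u,v)\iff s\#u\vee t\#v$. A relation $\alpha$ is strongly irreflexive if $(x,y)\in\alpha\Rightarrow x\#y$; co-transitive if $(x,y)\in\alpha\Rightarrow\forall z((x,z)\in\alpha\vee(z,y)\in\alpha)$; co-antisymmetric if $x\#y\Rightarrow(x,y)\in\alpha\vee(y,x)\in\alpha$. Co-quasiorder: strongly irreflexive and co-transitive; co-equivalence: symmetric co-quasiorder; co-order: co-antisymmetric co-quasiorder. A (co-quasi)ordered set with apartness is a set with apartness with a co-quasiorder (co-order). For a co-quasiorder $\kappa$, $\kappa^c={\sim}\kappa=\{(x,y):\forall(a,b)\in\kappa\,((x,y)\#(a,b))\}$ (equal to the logical complement). For a co-equivalence $\kappa$ on $S$, $S/\kappa^c$ has equality $x\kappa^c=y\kappa^c\iff(x,y)\in\kappa^c$ and apartness $x\kappa^c\#y\kappa^c\iff(x,y)\in\kappa$. Mappings are extensional functions; se-mapping: $f(x)\#f(y)\Rightarrow x\#y$; a-injective: $x\#y\Rightarrow f(x)\#f(y)$. $\mathrm{coker}\,f=\{(x,y):f(x)\#f(y)\}$; $\mu_f=\{(x,y)\in S\times S:(f(x),f(y))\in\sigma\}$; $\kappa_\sigma=\sigma\cup\sigma^{ -1}$ and $(u\kappa_\sigma^c,v\kappa_\sigma^c)\in\Upsilon_\sigma\iff(u,v)\in\sigma$.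 $\pi_f:S\to S/\kappa_f^c$ and $\pi_\sigma:T\to T/\kappa_\sigma^c$ are the quotient maps. A map $g$ between sets with relations $\alpha,\beta$ is isotone if $(x,y)\in\alpha\Rightarrow(g(x),g(y))\in\beta$, reverse isotone if the converse implication holds. -}

module Defs where

open import Level using (Level; _⊔_; suc)
open import Relation.Binary.Core using (Rel)
open import Relation.Binary.Structures using (IsEquivalence)
open import Relation.Nullary using (¬_)
open import Data.Sum using (_⊎_)
open import Data.Product using (_×_)

-- Sets with apartness (Bishop-style): a carrier with an equality (equivalence)
-- and an apartness relation; the quotient S/κᶜ is represented as the same
-- carrier with a different equality/apartness, so this is a predicate on
-- (≈, #) over a carrier type.
record IsSetWithApartness {a ℓ₁ ℓ₂} {A : Set a}
         (_≈_ : Rel A ℓ₁) (_#_ : Rel A ℓ₂) : Set (a ⊔ ℓ₁ ⊔ ℓ₂) where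
  field
    isEquivalence : IsEquivalence _≈_
    inhabitant    : A
    #-irrefl      : ∀ {x} → ¬ (x # x)
    #-sym         : ∀ {x y} → x # y → y # x
    #-cotrans     : ∀ {x z} → x # z → ∀ y → (x # y) ⊎ (y # z)
    #-ext         : ∀ {x x′ y y′} → x ≈ x′ → y ≈ y′ → x # y → x′ # y′

record SetWithApartness c ℓ₁ ℓ₂ : Set (suc (c ⊔ ℓ₁ ⊔ ℓ₂)) where
  field
    Carrier            : Set c
    _≈_                : Rel Carrier ℓ₁
    _#_                : Rel Carrier ℓ₂
    isSetWithApartness : IsSetWithApartness _≈_ _#_
  open IsSetWithApartness isSetWithApartness public

module _ {a ℓ₂ : Level} {A : Set a} (_#_ : Rel A ℓ₂) where

  StronglyIrreflexive : ∀ {ℓ} → Rel A ℓ → Set (a ⊔ ℓ ⊔ ℓ₂)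
  StronglyIrreflexive α = ∀ {x y} → α x y → x # y

  CoAntisymmetric : ∀ {ℓ} → Rel A ℓ → Set (a ⊔ ℓ ⊔ ℓ₂)
  CoAntisymmetric α = ∀ {x y} → x # y → α x y ⊎ α y x

  -- κᶜ = {(x,y) : ∀ (a,b) ∈ κ, (x,y) # (a,b)}, with
  -- (x,y) # (a,b) ⇔ x # a ∨ y # b  (apartness on S × S)
  Compl : ∀ {ℓ} → Rel A ℓ → Rel A (a ⊔ ℓ ⊔ ℓ₂)
  Compl κ x y = ∀ u v → κ u v → (x # u) ⊎ (y # v)

CoTransitive : ∀ {a ℓ} {A : Set a} → Rel A ℓ → Set (a ⊔ ℓ)
CoTransitive α = ∀ {x y} → α x y → ∀ z → α x z ⊎ α z y

SymmetricRel : ∀ {a ℓ} {A : Set a} → Rel A ℓ → Set (a ⊔ ℓ)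
SymmetricRel α = ∀ {x y} → α x y → α y x

record IsCoQuasiorder {a ℓ₂ ℓ} {A : Set a} (_#_ : Rel A ℓ₂) (α : Rel A ℓ)
         : Set (a ⊔ ℓ ⊔ ℓ₂) where
  field
    strongIrrefl : StronglyIrreflexive _#_ α
    coTrans      : CoTransitive α

record IsCoEquivalence {a ℓ₂ ℓ} {A : Set a} (_#_ : Rel A ℓ₂) (α : Rel A ℓ)
         : Set (a ⊔ ℓ ⊔ ℓ₂) where
  field
    isCoQuasiorder : IsCoQuasiorder _#_ α
    sym            : SymmetricRel α

record IsCoOrder {a ℓ₂ ℓ} {A : Set a} (_#_ : Rel A ℓ₂) (α : Rel A ℓ)
         : Set (a ⊔ ℓ ⊔ ℓ₂) where
  field
    isCoQuasiorder : IsCoQuasiorder _#_ α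
    coAntisym      : CoAntisymmetric _#_ α

_⊆_ : ∀ {a ℓ ℓ′} {A : Set a} → Rel A ℓ → Rel A ℓ′ → Set (a ⊔ ℓ ⊔ ℓ′)
α ⊆ β = ∀ {x y} → α x y → β x y

_≐_ : ∀ {a ℓ ℓ′} {A : Set a} → Rel A ℓ → Rel A ℓ′ → Set (a ⊔ ℓ ⊔ ℓ′)
α ≐ β = (α ⊆ β) × (β ⊆ α)

WellDefined : ∀ {a ℓ₁ ℓ} {A : Set a} → Rel A ℓ₁ → Rel A ℓ → Set (a ⊔ ℓ₁ ⊔ ℓ)
WellDefined _≈_ α = ∀ {x x′ y y′} → x ≈ x′ → y ≈ y′ → α x y → α x′ y′

module _ {a b ℓ₁ ℓ₂ : Level} {A : Set a} {B : Set b} where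

  Extensional : Rel A ℓ₁ → Rel B ℓ₂ → (A → B) → Set (a ⊔ ℓ₁ ⊔ ℓ₂)
  Extensional _≈₁_ _≈₂_ g = ∀ {x y} → x ≈₁ y → g x ≈₂ g y

  SeMapping : Rel A ℓ₁ → Rel B ℓ₂ → (A → B) → Set (a ⊔ ℓ₁ ⊔ ℓ₂)
  SeMapping _#₁_ _#₂_ g = ∀ {x y} → g x #₂ g y → x #₁ y

  AInjective : Rel A ℓ₁ → Rel B ℓ₂ → (A → B) → Set (a ⊔ ℓ₁ ⊔ ℓ₂)
  AInjective _#₁_ _#₂_ g = ∀ {x y} → x #₁ y → g x #₂ g y

  Isotone : Rel A ℓ₁ → Rel B ℓ₂ → (A → B) → Set (a ⊔ ℓ₁ ⊔ ℓ₂)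
  Isotone α β g = ∀ {x y} → α x y → β (g x) (g y)

  ReverseIsotone : Rel A ℓ₁ → Rel B ℓ₂ → (A → B) → Set (a ⊔ ℓ₁ ⊔ ℓ₂)
  ReverseIsotone α β g = ∀ {x y} → β (g x) (g y) → α x y

μ : ∀ {a b ℓ} {A : Set a} {B : Set b} → (A → B) → Rel B ℓ → Rel A ℓ
μ f σ x y = σ (f x) (f y)

κ : ∀ {a ℓ} {A : Set a} → Rel A ℓ → Rel A ℓ
κ α x y = α x y ⊎ α y x

coker : ∀ {a b ℓ} {A : Set a} {B : Set b} → Rel B ℓ → (A → B) → Rel A ℓ
coker _#_ f x y = f x # f y

-- The quotient S/κᶜ is represented on the carrier of S with equality
-- Compl _#_ κ and apartness κ; the class x κᶜ is represented by x, so the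
-- quotient map π is the identity on carriers, and ψ(x κ_fᶜ) = f(x) κ_σᶜ
-- is f on representatives.
π : ∀ {a} {A : Set a} → A → A
π x = x

ψ : ∀ {a b} {A : Set a} {B : Set b} → (A → B) → A → B
ψ f x = f x

{-# OPTIONS --safe #-}
-- For a co-equivalence κ over an irreflexive apartness, the complement
-- Compl _#_ κ coincides with the logical complement of κ; co-transitivity
-- then makes the complement an equivalence and every co-transitive relation
-- contained in κ and κ⁻¹ well defined on the classes, which yields the
-- quotient S/κ_fᶜ with its co-order Υ_f = μ_f.  Since κ (μ f σ) relates x, y
-- exactly when κ σ relates f x, f y, the properties of ψ are instances of
-- these facts on T.
module Submission where

open import Defs
open import Level using (Level)
open import Relation.Binary.Core using (Rel)
open import Relation.Binary.Structures using (IsEquivalence)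
open import Data.Product using (_×_; _,_)
open import Data.Sum using (inj₁; inj₂)
open import Data.Empty using (⊥; ⊥-elim)
open import Function using (id; flip)
open import Relation.Nullary using (¬_)
open SetWithApartness using (Carrier; _≈_; _#_)

module _ {a : Level} {A : Set a} where

  κ-sym : ∀ {ℓ} {α : Rel A ℓ} → SymmetricRel (κ α)
  κ-sym (inj₁ p) = inj₂ p
  κ-sym (inj₂ p) = inj₁ p

  κ-coTrans : ∀ {ℓ} {α : Rel A ℓ} → CoTransitive α → CoTransitive (κ α)
  κ-coTrans coTrans (inj₁ p) z with coTrans p z
  ... | inj₁ q = inj₁ (inj₁ q)
  ... | inj₂ q = inj₂ (inj₁ q)
  κ-coTrans coTrans (inj₂ p) z with coTrans p z
  ... | inj₁ q = inj₂ (inj₂ q)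
  ... | inj₂ q = inj₁ (inj₂ q)

  -- Υ = α is a co-order for the apartness κ α of the quotient.
  κ-isCoOrder : ∀ {ℓ} {α : Rel A ℓ} → CoTransitive α → IsCoOrder (κ α) α
  κ-isCoOrder coTrans = record
    { isCoQuasiorder = record { strongIrrefl = inj₁ ; coTrans = coTrans }
    ; coAntisym      = id }

module _ {a ℓ₂ : Level} {A : Set a} {_#_ : Rel A ℓ₂} where

  κ-strongIrrefl : ∀ {ℓ} {α : Rel A ℓ} → SymmetricRel _#_ →
                   StronglyIrreflexive _#_ α → StronglyIrreflexive _#_ (κ α)
  κ-strongIrrefl #-sym irr (inj₁ p) = irr p
  κ-strongIrrefl #-sym irr (inj₂ p) = #-sym (irr p)

  κ-isCoEquivalence : ∀ {ℓ} {α : Rel A ℓ} → SymmetricRel _#_ →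
                      IsCoQuasiorder _#_ α → IsCoEquivalence _#_ (κ α)
  κ-isCoEquivalence {α = α} #-sym q = record
    { isCoQuasiorder = record
      { strongIrrefl = κ-strongIrrefl #-sym strongIrrefl
      ; coTrans      = κ-coTrans coTrans }
    ; sym            = κ-sym {α = α} }
    where open IsCoQuasiorder q

  coOrder⇒κ≐# : ∀ {ℓ} {α : Rel A ℓ} → SymmetricRel _#_ →
                IsCoOrder _#_ α → κ α ≐ _#_
  coOrder⇒κ≐# #-sym co =
    κ-strongIrrefl #-sym (IsCoQuasiorder.strongIrrefl isCoQuasiorder) , coAntisym
    where open IsCoOrder co

  module _ (#-irrefl : ∀ {x} → ¬ (x # x)) where

    Compl⇒¬ : ∀ {ℓ} {κ′ : Rel A ℓ} {x y} → Compl _#_ κ′ x y → ¬ κ′ x y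
    Compl⇒¬ c k with c _ _ k
    ... | inj₁ x#x = #-irrefl x#x
    ... | inj₂ y#y = #-irrefl y#y

    Compl-wellDefined : ∀ {ℓ ℓ′} {α : Rel A ℓ} {κ′ : Rel A ℓ′} →
                        CoTransitive α → α ⊆ κ′ → flip α ⊆ κ′ →
                        WellDefined (Compl _#_ κ′) α
    Compl-wellDefined coTrans α⊆κ α⁻¹⊆κ {x′ = x′} {y′ = y′} cx cy p
      with coTrans p x′
    ... | inj₁ αxx′ = ⊥-elim (Compl⇒¬ cx (α⊆κ αxx′))
    ... | inj₂ αx′y with coTrans αx′y y′
    ...   | inj₁ αx′y′ = αx′y′
    ...   | inj₂ αy′y = ⊥-elim (Compl⇒¬ cy (α⁻¹⊆κ αy′y))

  module _ {ℓ} {κ′ : Rel A ℓ} (coEq : IsCoEquivalence _#_ κ′) where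
    open IsCoEquivalence coEq
    open IsCoQuasiorder isCoQuasiorder

    ¬⇒Compl : ∀ {x y} → ¬ κ′ x y → Compl _#_ κ′ x y
    ¬⇒Compl {x} {y} ¬κxy u v κuv with coTrans κuv x
    ... | inj₁ κux = inj₁ (strongIrrefl (sym κux))
    ... | inj₂ κxv with coTrans κxv y
    ...   | inj₁ κxy = ⊥-elim (¬κxy κxy)
    ...   | inj₂ κyv = inj₂ (strongIrrefl κyv)

    Compl-isEquivalence : (∀ {x} → ¬ (x # x)) → IsEquivalence (Compl _#_ κ′)
    Compl-isEquivalence #-irrefl = record
      { refl  = ¬⇒Compl (λ κxx → #-irrefl (strongIrrefl κxx))
      ; sym   = λ c → ¬⇒Compl (λ κyx → Compl⇒¬ #-irrefl c (sym κyx))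
      ; trans = λ {_} {y} c d → ¬⇒Compl λ κxz → case κxz y c d }
      where
      case : ∀ {x z} → κ′ x z → ∀ y →
             Compl _#_ κ′ x y → Compl _#_ κ′ y z → ⊥
      case κxz y c d with coTrans κxz y
      ... | inj₁ κxy = Compl⇒¬ #-irrefl c κxy
      ... | inj₂ κyz = Compl⇒¬ #-irrefl d κyz

    quotient-isSetWithApartness : ∀ {ℓ₁} {_≈′_ : Rel A ℓ₁} →
      IsSetWithApartness _≈′_ _#_ → IsSetWithApartness (Compl _#_ κ′) κ′
    quotient-isSetWithApartness apartness = record
      { isEquivalence = Compl-isEquivalence #-irrefl
      ; inhabitant    = inhabitant
      ; #-irrefl      = λ κxx → #-irrefl (strongIrrefl κxx)
      ; #-sym         = sym
      ; #-cotrans     = coTrans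
      ; #-ext         = Compl-wellDefined #-irrefl coTrans id sym }
      where open IsSetWithApartness apartness using (inhabitant; #-irrefl)

module _ {a b ℓ₂ ℓ₄ : Level} {A : Set a} {B : Set b}
         {_#₁_ : Rel A ℓ₂} {_#₂_ : Rel B ℓ₄} where

  μ-isCoQuasiorder : ∀ {ℓ} {σ : Rel B ℓ} {f : A → B} →
                     SeMapping _#₁_ _#₂_ f → IsCoQuasiorder _#₂_ σ →
                     IsCoQuasiorder _#₁_ (μ f σ)
  μ-isCoQuasiorder {f = f} se q = record
    { strongIrrefl = λ p → se (strongIrrefl p)
    ; coTrans      = λ p z → coTrans p (f z) }
    where open IsCoQuasiorder q

  Compl-map : ∀ {ℓ} {κ′ : Rel B ℓ} {f : A → B} → (∀ {x} → ¬ (x #₁ x)) →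
              IsCoEquivalence _#₂_ κ′ →
              Extensional (Compl _#₁_ (λ x y → κ′ (f x) (f y))) (Compl _#₂_ κ′) f
  Compl-map #-irrefl coEq c = ¬⇒Compl coEq (Compl⇒¬ #-irrefl c)

theorem17 : ∀ {c₁ ℓ₁ ℓ₂ c₂ ℓ₃ ℓ₄ ℓσ : Level}
    (S : SetWithApartness c₁ ℓ₁ ℓ₂) (T : SetWithApartness c₂ ℓ₃ ℓ₄)
    (σ : Rel (Carrier T) ℓσ) → IsCoQuasiorder (_#_ T) σ →
    (f : Carrier S → Carrier T) →
    Extensional (_≈_ S) (_≈_ T) f → SeMapping (_#_ S) (_#_ T) f →
    -- (i)
    IsCoQuasiorder (_#_ S) (μ f σ)
    -- (ii)
    × (IsCoEquivalence (_#_ S) (κ (μ f σ)) × (κ (μ f σ) ⊆ coker (_#_ T) f))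
    -- (iii)
    × (IsCoOrder (_#_ T) σ → κ (μ f σ) ≐ coker (_#_ T) f)
    -- (iv)
    × (IsSetWithApartness (Compl (_#_ S) (κ (μ f σ))) (κ (μ f σ))
       × WellDefined (Compl (_#_ S) (κ (μ f σ))) (μ f σ)
       × IsCoOrder (κ (μ f σ)) (μ f σ))
    -- (v)
    × (WellDefined (Compl (_#_ T) (κ σ)) σ
       × Extensional (Compl (_#_ S) (κ (μ f σ))) (Compl (_#_ T) (κ σ)) (ψ f)
       × Isotone (μ f σ) σ (ψ f)
       × ReverseIsotone (μ f σ) σ (ψ f)
       × AInjective (κ (μ f σ)) (κ σ) (ψ f)
       × SeMapping (κ (μ f σ)) (κ σ) (ψ f)
       × (∀ x → Compl (_#_ T) (κ σ) (ψ f (π x)) (π (f x))))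
theorem17 S T σ σ-coQuasi f _ se =
    μ-coQuasi
  , (κμ-coEq , κ-strongIrrefl {α = σ} (#-sym T) (strongIrrefl σ-coQuasi))
  , (λ σ-coOrder → let κσ⊆# , #⊆κσ = coOrder⇒κ≐# (#-sym T) σ-coOrder
                   in (λ k → κσ⊆# k) , (λ p → #⊆κσ p))
  , ( quotient-isSetWithApartness κμ-coEq (isSetWithApartness S)
    , Compl-wellDefined (#-irrefl S) (coTrans μ-coQuasi) inj₁ inj₂
    , κ-isCoOrder (coTrans μ-coQuasi))
  , ( Compl-wellDefined (#-irrefl T) (coTrans σ-coQuasi) inj₁ inj₂
    , Compl-map (#-irrefl S) κσ-coEq
    , id , id , id , id
    , (λ x → IsEquivalence.refl (Compl-isEquivalence κσ-coEq (#-irrefl T)) {f x}))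
  where
  open SetWithApartness using (isSetWithApartness; #-irrefl; #-sym)
  open IsCoQuasiorder using (strongIrrefl; coTrans)

  μ-coQuasi : IsCoQuasiorder (_#_ S) (μ f σ)
  μ-coQuasi = μ-isCoQuasiorder se σ-coQuasi

  κμ-coEq : IsCoEquivalence (_#_ S) (κ (μ f σ))
  κμ-coEq = κ-isCoEquivalence (#-sym S) μ-coQuasi

  κσ-coEq : IsCoEquivalence (_#_ T) (κ σ)
  κσ-coEq = κ-isCoEquivalence (#-sym T) σ-coQuasi
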